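{- Let $X$ be a finite temporal Esakia space and $x\in X$. Then $x$ is a topo-root iff $x$ is a $Z$-root of the underlying temporal transit. Moreover, $X$ is topo-connected iff its underlying temporal transit is $Z$-connected.
   Context: A temporal Esakia space is a structure $(X,R^{\triangleleft},R^{\triangleright},\le,\Omega)$ such that $(X,\le,\Omega)$ is an Esakia space, $\le$ is the reflexive closure of $R^{\triangleright}$, $R^{\triangleleft}$ is the converse of $R^{\triangleright}$, for every clopen upset $K$ the sets $\{x:R^{\triangleright}[x]\subseteq K\}$ and $R^{\triangleright}[K]$ are clopen upsets, and the sets $R^{\triangleright}[x]$, $R^{\triangleleft}[x]$ are closed. Its underlying temporal transit is $(X,R^{\triangleleft},R^{\triangleright},\le)$. A subset $S$ is archival if for all $x,z$: if $x\notin S$, $z\in S$ and $zR^{\triangleleft}x$, then $R^{\triangleleft}[z]\cap{\uparrow}x\cap S\neq\emptyset$. $x\trianglelefteq y$ means $y$ lies in every closed archival upset containing $x$; $x$ is a topo-root if $x\trianglelefteq z$ for all $z$; $X$ is topo-connected if every point is a topo-root. $\mathrm{Refl}(X)=\{v:vR^{\triangleright}v\}$; $xBw$ means $w\le x$ and $\{v:w<v\le x\}\cap\mathrm{Refl}(X)=\emptyset$; $Z_0=\Delta_X$, $Z_{n+1}=Z_n;B;\le$ (where $R;R'=\{(x,z):\exists y\,(xRy,\ yR'z)\}$), $Z=\bigcup_nZ_n$. A point $x$ is a $Z$-root if $xZz$ for all $z$; the transit is $Z$-connected if every point is a $Z$-root. -}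

module Defs where

open import Data.Nat using (ℕ; zero; suc)
open import Data.Fin using (Fin)
open import Data.Bool using (Bool; true; false; not; _∧_; _∨_)
open import Data.Product using (Σ; ∃; ∃-syntax; _×_; _,_)
open import Data.Sum using (_⊎_)
open import Relation.Nullary using (¬_)
open import Relation.Binary.PropositionalEquality using (_≡_; _≢_)
open import Function.Bundles using (_⇔_)
open import Level using (0ℓ) renaming (suc to lsuc)

-- Subsets of the finite carrier Fin n are represented by characteristic
-- functions Fin n → Bool (on a finite set these are all subsets).
Subset : ℕ → Set
Subset n = Fin n → Bool

_∈ₛ_ : ∀ {n} → Fin n → Subset n → Set
x ∈ₛ S = S x ≡ true

_∉ₛ_ : ∀ {n} → Fin n → Subset n → Set
x ∉ₛ S = S x ≡ false

-- Because the carrier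
-- is finite there are only finitely many subsets, so closure under binary
-- unions and the empty union is closure under arbitrary unions.
record Topology (n : ℕ) : Set₁ where
  field
    Open      : Subset n → Set
    open-ext  : ∀ U V → (∀ x → U x ≡ V x) → Open U → Open V
    open-∅    : Open (λ _ → false)
    open-full : Open (λ _ → true)
    open-∩    : ∀ U V → Open U → Open V → Open (λ x → U x ∧ V x)
    open-∪    : ∀ U V → Open U → Open V → Open (λ x → U x ∨ V x)

  Closed : Subset n → Set
  Closed S = Open (λ x → not (S x))

  Clopen : Subset n → Set
  Clopen S = Open S × Closed S

-- "the set {x | P x} is (represented by) a subset satisfying Q"
IsSetWith : ∀ {n} → (Fin n → Set) → (Subset n → Set) → Set
IsSetWith {n} P Q = Σ (Subset n) λ U → Q U × (∀ x → (x ∈ₛ U) ⇔ P x)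

-- A finite temporal Esakia space on carrier Fin n.
-- Compactness is automatic since the carrier is finite.
record FiniteTemporalEsakiaSpace (n : ℕ) : Set₁ where
  field
    top  : Topology n
    _≤_  : Fin n → Fin n → Set
    R◁   : Fin n → Fin n → Set
    R▷   : Fin n → Fin n → Set
  open Topology top public

  UpSet : Subset n → Set
  UpSet S = ∀ x y → x ≤ y → x ∈ₛ S → y ∈ₛ S

  field
    ≤-refl    : ∀ x → x ≤ x
    ≤-trans   : ∀ x y z → x ≤ y → y ≤ z → x ≤ z
    ≤-antisym : ∀ x y → x ≤ y → y ≤ x → x ≡ y
    priestley : ∀ x y → ¬ (x ≤ y) →
                Σ (Subset n) λ U → Clopen U × UpSet U × x ∈ₛ U × y ∉ₛ U
    esakia    : ∀ U → Clopen U → IsSetWith (λ x → ∃[ u ] (u ∈ₛ U × x ≤ u)) Clopen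
    ≤-reflClosure : ∀ x y → (x ≤ y) ⇔ (x ≡ y ⊎ R▷ x y)
    R◁-converse   : ∀ x y → R◁ x y ⇔ R▷ y x
    box-clopenUp  : ∀ K → Clopen K → UpSet K →
                    IsSetWith (λ x → ∀ y → R▷ x y → y ∈ₛ K) (λ U → Clopen U × UpSet U)
    image-clopenUp : ∀ K → Clopen K → UpSet K →
                    IsSetWith (λ y → ∃[ k ] (k ∈ₛ K × R▷ k y)) (λ U → Clopen U × UpSet U)
    R▷-closed : ∀ x → IsSetWith (R▷ x) Closed
    R◁-closed : ∀ x → IsSetWith (R◁ x) Closed

module _ {n : ℕ} (X : FiniteTemporalEsakiaSpace n) where
  open FiniteTemporalEsakiaSpace X

  Archival : Subset n → Set
  Archival S = ∀ x z → x ∉ₛ S → z ∈ₛ S → R◁ z x →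
               ∃[ y ] (R◁ z y × x ≤ y × y ∈ₛ S)

  _⊴_ : Fin n → Fin n → Set
  x ⊴ y = ∀ S → Closed S → Archival S → UpSet S → x ∈ₛ S → y ∈ₛ S

  IsTopoRoot : Fin n → Set
  IsTopoRoot x = ∀ z → x ⊴ z

  TopoConnected : Set
  TopoConnected = ∀ x → IsTopoRoot x

  -- Notions on the underlying temporal transit (only ≤ and R▷ are used)
  Refl : Fin n → Set
  Refl v = R▷ v v

  _<_ : Fin n → Fin n → Set
  w < v = w ≤ v × w ≢ v

  B : Fin n → Fin n → Set
  B x w = w ≤ x × (∀ v → w < v → v ≤ x → ¬ Refl v)

  Zₙ : ℕ → Fin n → Fin n → Set
  Zₙ zero    x z = x ≡ z
  Zₙ (suc k) x z = ∃[ y ] (Zₙ k x y × ∃[ w ] (B y w × w ≤ z))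

  Z : Fin n → Fin n → Set
  Z x z = ∃[ k ] Zₙ k x z

  IsZRoot : Fin n → Set
  IsZRoot x = ∀ z → Z x z

  ZConnected : Set
  ZConnected = ∀ x → IsZRoot x

-- In a finite poset the strict order and its converse are well-founded, and a finite T₁
-- space is discrete, so closedness is no restriction in the definition of ⊴.
-- The heart of the argument is that a set S is archival exactly when it is closed under B.
-- If y ∈ S, y B w and w ∉ S, archivality yields y′ ∈ S with w ≤ y′ R▷ y; y′ = y would be a
-- reflexive point forbidden by y B w, so y′ < y and y′ B w, and we descend. Conversely, if
-- x ∉ S and x R▷ z ∈ S, then z B x is impossible, so some reflexive point lies strictly
-- between x and z; a maximal one u satisfies z B u, whence u ∈ S and u R▷ z.
-- Hence x ⊴ z iff z lies in every upset containing x closed under B, and the least such set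
-- is the union of the increasing chain Zₙ k x, which stabilises because Fin n is finite.
module Submission where

open import Defs
open import Data.Nat using (ℕ; zero; suc)
open import Data.Fin using (Fin; _≟_) renaming (zero to fzero; suc to fsuc)
open import Data.Fin.Properties using (any?)
open import Data.Fin.Induction using (po-wellFounded; po-noetherian)
import Data.Fin.Subset as FinSubset
open import Data.Fin.Subset.Induction using (⊃-wellFounded)
open import Data.Vec using (tabulate)
open import Data.Vec.Properties using (lookup∘tabulate; lookup⇒[]=; []=⇒lookup)
open import Data.Bool using (true; false; not; _∧_; _∨_)
open import Data.Bool.Properties using (not-involutive; not-¬; ¬-not)
open import Data.Product using (∃-syntax; _×_; _,_; proj₁; proj₂; uncurry)
open import Data.Sum using (_⊎_; inj₁; inj₂)
open import Function using (_∘_; flip)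
open import Function.Bundles using (_⇔_; mk⇔; Equivalence)
open import Induction.WellFounded using (WellFounded; Acc; acc)
open import Level using (Level)
open import Relation.Binary.Structures using (IsPartialOrder)
open import Relation.Binary.PropositionalEquality
  using (_≡_; _≢_; refl; sym; trans; cong; subst; isEquivalence)
open import Relation.Nullary using (¬_; Dec; yes; no; does; contradiction)
open import Relation.Nullary.Decidable using (_×-dec_; _⊎-dec_; ¬?; map′; dec-true; decidable-stable)
open import Relation.Unary using (Pred; _⊆_) renaming (Decidable to Decidableₚ)

open Equivalence using (to; from)

private
  variable
    ℓ : Level
    m n : ℕ

∉∈⇒≢ : ∀ {x y : Fin n} {S} → x ∉ₛ S → y ∈ₛ S → x ≢ y
∉∈⇒≢ x∉S y∈S refl = not-¬ x∉S y∈S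

≡true-⇔⇒≡ : ∀ {a b} → (a ≡ true → b ≡ true) → (b ≡ true → a ≡ true) → a ≡ b
≡true-⇔⇒≡ {false} {false} _   _   = refl
≡true-⇔⇒≡ {false} {true}  _   b⇒a = b⇒a refl
≡true-⇔⇒≡ {true}          a⇒b _   = sym (a⇒b refl)

does-true⇒ : ∀ {A : Set ℓ} (a? : Dec A) → does a? ≡ true → A
does-true⇒ (yes a) _ = a

toSubset : {P : Pred (Fin n) ℓ} → Decidableₚ P → Subset n
toSubset P? = does ∘ P?

module _ {P : Pred (Fin n) ℓ} (P? : Decidableₚ P) where

  toSubset⁺ : ∀ {x} → P x → x ∈ₛ toSubset P?
  toSubset⁺ {x} = dec-true (P? x)

  toSubset⁻ : ∀ {x} → x ∈ₛ toSubset P? → P x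
  toSubset⁻ {x} = does-true⇒ (P? x)

IsSetWith⇒Decidable : {P : Fin n → Set} {Q : Subset n → Set} → IsSetWith P Q → Decidableₚ P
IsSetWith⇒Decidable (U , _ , U⇔P) x with U x in eq
... | true  = yes (to (U⇔P x) eq)
... | false = no (not-¬ eq ∘ from (U⇔P x))

module _ {P : ℕ → Pred (Fin n) ℓ} (P? : ∀ k → Decidableₚ (P k))
         (P-mono : ∀ k → P k ⊆ P (suc k)) where

  private
    chain : ℕ → FinSubset.Subset n
    chain k = tabulate (toSubset (P? k))

    ∈chain⁺ : ∀ {k i} → P k i → i FinSubset.∈ chain k
    ∈chain⁺ {k} {i} p = lookup⇒[]= i (chain k) (trans (lookup∘tabulate _ i) (toSubset⁺ (P? k) p))

    ∈chain⁻ : ∀ {k i} → i FinSubset.∈ chain k → P k i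
    ∈chain⁻ {k} {i} i∈ = toSubset⁻ (P? k) (trans (sym (lookup∘tabulate _ i)) ([]=⇒lookup i∈))

    stabilisesFrom : ∀ k → Acc FinSubset._⊃_ (chain k) → ∃[ j ] P (suc j) ⊆ P j
    stabilisesFrom k (acc larger) with any? (λ i → P? (suc k) i ×-dec ¬? (P? k i))
    ... | no noNew = k , λ {i} p → decidable-stable (P? k i) (λ ¬p → noNew (i , p , ¬p))
    ... | yes (i , p , ¬p) =
      stabilisesFrom (suc k)
        (larger ((∈chain⁺ ∘ P-mono k ∘ ∈chain⁻) , i , ∈chain⁺ p , ¬p ∘ ∈chain⁻))

  increasing-stabilises : ∃[ j ] P (suc j) ⊆ P j
  increasing-stabilises = stabilisesFrom 0 (⊃-wellFounded _)

⋂ : (Fin m → Subset n) → Subset n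
⋂ {zero}  F y = true
⋂ {suc m} F y = F fzero y ∧ ⋂ (F ∘ fsuc) y

∈-⋂⁺ : ∀ (F : Fin m → Subset n) {y} → (∀ i → y ∈ₛ F i) → y ∈ₛ ⋂ F
∈-⋂⁺ {zero}  F y∈F = refl
∈-⋂⁺ {suc m} F y∈F rewrite y∈F fzero = ∈-⋂⁺ (F ∘ fsuc) (y∈F ∘ fsuc)

∈-⋂⁻ : ∀ (F : Fin m → Subset n) {y} → y ∈ₛ ⋂ F → ∀ i → y ∈ₛ F i
∈-⋂⁻ {suc m} F {y} y∈⋂ i with F fzero y in eq | i
... | true | fzero  = eq
... | true | fsuc i = ∈-⋂⁻ (F ∘ fsuc) y∈⋂ i

⋂-preserves : (Q : Subset n → Set) → Q (λ _ → true) →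
              (∀ {U V} → Q U → Q V → Q (λ y → U y ∧ V y)) →
              (F : Fin m → Subset n) → (∀ i → Q (F i)) → Q (⋂ F)
⋂-preserves {m = zero}  Q Q-full Q-∧ F QF = Q-full
⋂-preserves {m = suc m} Q Q-full Q-∧ F QF =
  Q-∧ (QF fzero) (⋂-preserves Q Q-full Q-∧ (F ∘ fsuc) (QF ∘ fsuc))

module _ (τ : Topology n) where
  open Topology τ

  closed-∧ : ∀ {U V} → Closed U → Closed V → Closed (λ y → U y ∧ V y)
  closed-∧ {U} {V} U-closed V-closed =
    open-ext _ _ (λ y → deMorgan (U y) (V y)) (open-∪ _ _ U-closed V-closed)
    where
    deMorgan : ∀ a b → not a ∨ not b ≡ not (a ∧ b)
    deMorgan true  b = refl
    deMorgan false b = refl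

  module _ (separate : ∀ x y → x ≢ y → ∃[ U ] Open U × x ∈ₛ U × y ∉ₛ U) where

    private
      avoiding : Fin n → Fin n → Subset n
      avoiding x i with i ≟ x
      ... | yes _  = λ _ → true
      ... | no i≢x = proj₁ (separate x i (i≢x ∘ sym))

      avoiding-open : ∀ x i → Open (avoiding x i)
      avoiding-open x i with i ≟ x
      ... | yes _  = open-full
      ... | no i≢x = proj₁ (proj₂ (separate x i (i≢x ∘ sym)))

      ∈avoiding : ∀ x i → x ∈ₛ avoiding x i
      ∈avoiding x i with i ≟ x
      ... | yes _  = refl
      ... | no i≢x = proj₁ (proj₂ (proj₂ (separate x i (i≢x ∘ sym))))

      ∉avoiding : ∀ x i → i ≢ x → i ∉ₛ avoiding x i
      ∉avoiding x i i≢x with i ≟ x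
      ... | yes i≡x = contradiction i≡x i≢x
      ... | no _    = proj₂ (proj₂ (proj₂ (separate x i (i≢x ∘ sym))))

    singleton : Fin n → Subset n
    singleton x = ⋂ (avoiding x)

    singleton-open : ∀ x → Open (singleton x)
    singleton-open x = ⋂-preserves Open open-full (open-∩ _ _) (avoiding x) (avoiding-open x)

    ∈singleton : ∀ x → x ∈ₛ singleton x
    ∈singleton x = ∈-⋂⁺ (avoiding x) (∈avoiding x)

    ∈singleton⇒≡ : ∀ {x y} → y ∈ₛ singleton x → y ≡ x
    ∈singleton⇒≡ {x} {y} y∈ with y ≟ x
    ... | yes y≡x = y≡x
    ... | no y≢x  = contradiction (∈-⋂⁻ (avoiding x) y∈ y) (not-¬ (∉avoiding x y y≢x))

    T₁⇒closed : ∀ S → Closed S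
    T₁⇒closed S =
      open-ext _ _ (λ y → cong not (⋂K≡S y)) (⋂-preserves Closed open-∅ closed-∧ K K-closed)
      where
      -- S is the intersection of the complements of the singletons {j} with j ∉ S.
      K : Fin n → Subset n
      K j y = S j ∨ not (singleton j y)

      K-closed : ∀ j → Closed (K j)
      K-closed j with S j
      ... | true  = open-∅
      ... | false = open-ext _ _ (λ y → sym (not-involutive _)) (singleton-open j)

      ⋂K≡S : ∀ y → ⋂ K y ≡ S y
      ⋂K≡S y = ≡true-⇔⇒≡ (λ y∈⋂K → Ky⇒S (∈-⋂⁻ K y∈⋂K y)) (λ y∈S → ∈-⋂⁺ K (S⇒K y∈S))
        where
        Ky⇒S : y ∈ₛ K y → y ∈ₛ S
        Ky⇒S y∈Ky rewrite ∈singleton y with S y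
        ... | true = refl

        S⇒K : y ∈ₛ S → ∀ j → y ∈ₛ K j
        S⇒K y∈S j with S j in j∉S | singleton j y in y∈j
        ... | true  | _     = refl
        ... | false | false = refl
        ... | false | true  =
          contradiction (subst (_∈ₛ S) (∈singleton⇒≡ y∈j) y∈S) (not-¬ j∉S)

module _ (X : FiniteTemporalEsakiaSpace n) where
  open FiniteTemporalEsakiaSpace X

  ≤-isPartialOrder : IsPartialOrder _≡_ _≤_
  ≤-isPartialOrder = record
    { isPreorder = record
      { isEquivalence = isEquivalence
      ; reflexive     = λ { {x} refl → ≤-refl x }
      ; trans         = λ {x} {y} {z} → ≤-trans x y z
      }
    ; antisym = λ {x} {y} → ≤-antisym x y
    }

  <-wellFounded : WellFounded (_<_ X)
  <-wellFounded = po-wellFounded ≤-isPartialOrder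

  >-wellFounded : WellFounded (flip (_<_ X))
  >-wellFounded = po-noetherian ≤-isPartialOrder

  R▷⇒≤ : ∀ {x y} → R▷ x y → x ≤ y
  R▷⇒≤ {x} {y} = from (≤-reflClosure x y) ∘ inj₂

  <⇒R▷ : ∀ {x y} → _<_ X x y → R▷ x y
  <⇒R▷ {x} {y} (x≤y , x≢y) with to (≤-reflClosure x y) x≤y
  ... | inj₁ x≡y = contradiction x≡y x≢y
  ... | inj₂ xR▷y = xR▷y

  Refl-≤⇒R▷ : ∀ {u z} → Refl X u → u ≤ z → R▷ u z
  Refl-≤⇒R▷ {u} {z} uR▷u u≤z with u ≟ z
  ... | yes refl = uR▷u
  ... | no u≢z   = <⇒R▷ (u≤z , u≢z)

  R▷? : ∀ x y → Dec (R▷ x y)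
  R▷? x = IsSetWith⇒Decidable (R▷-closed x)

  _≤?_ : ∀ x y → Dec (x ≤ y)
  x ≤? y = map′ (from (≤-reflClosure x y)) (to (≤-reflClosure x y)) ((x ≟ y) ⊎-dec R▷? x y)

  _<?_ : ∀ x y → Dec (_<_ X x y)
  x <? y = (x ≤? y) ×-dec ¬? (x ≟ y)

  reflexive-between? : ∀ x z → Dec (∃[ v ] (_<_ X x v × v ≤ z × Refl X v))
  reflexive-between? x z = any? λ v → (x <? v) ×-dec (v ≤? z) ×-dec R▷? v v

  ¬reflexive-between⇒B : ∀ {w y} → w ≤ y → ¬ (∃[ v ] (_<_ X w v × v ≤ y × Refl X v)) → B X y w
  ¬reflexive-between⇒B w≤y none = w≤y , λ v w<v v≤y vR▷v → none (v , w<v , v≤y , vR▷v)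

  B? : ∀ y w → Dec (B X y w)
  B? y w = map′ (uncurry ¬reflexive-between⇒B)
                (λ (w≤y , none) → w≤y , λ (v , w<v , v≤y , vR▷v) → none v w<v v≤y vR▷v)
                ((w ≤? y) ×-dec ¬? (reflexive-between? w y))

  Zₙ? : ∀ k x z → Dec (Zₙ X k x z)
  Zₙ? zero    x z = x ≟ z
  Zₙ? (suc k) x z = any? λ y → Zₙ? k x y ×-dec any? λ w → B? y w ×-dec (w ≤? z)

  discrete : ∀ S → Closed S
  discrete = T₁⇒closed top separated
    where
    separated : ∀ x y → x ≢ y → ∃[ U ] Open U × x ∈ₛ U × y ∉ₛ U
    separated x y x≢y with x ≤? y
    ... | no x≰y with priestley x y x≰y
    ...   | U , (U-open , _) , _ , x∈U , y∉U = U , U-open , x∈U , y∉U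
    separated x y x≢y | yes x≤y with priestley y x (x≢y ∘ ≤-antisym x y x≤y)
    ...   | U , (_ , U-closed) , _ , y∈U , x∉U =
            (not ∘ U) , U-closed , cong not x∉U , cong not y∈U

  B-refl : ∀ z → B X z z
  B-refl z = ≤-refl z , λ v (z≤v , z≢v) v≤z _ → z≢v (≤-antisym z v z≤v v≤z)

  maximal-Refl-below : ∀ {v z} → Refl X v → v ≤ z → ∃[ u ] (Refl X u × v ≤ u × B X z u)
  maximal-Refl-below {v} {z} vR▷v v≤z = go (>-wellFounded v) vR▷v v≤z
    where
    go : ∀ {v} → Acc (flip (_<_ X)) v → Refl X v → v ≤ z → ∃[ u ] (Refl X u × v ≤ u × B X z u)
    go {v} (acc above) vR▷v v≤z with reflexive-between? v z
    ... | no none = v , vR▷v , ≤-refl v , ¬reflexive-between⇒B v≤z none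
    ... | yes (v′ , v<v′ , v′≤z , v′R▷v′) with go (above v<v′) v′R▷v′ v′≤z
    ...   | u , uR▷u , v′≤u , zBu = u , uR▷u , ≤-trans v v′ u (proj₁ v<v′) v′≤u , zBu

  B⊎Refl-above : ∀ {x z} → x ≤ z → B X z x ⊎ ∃[ u ] (Refl X u × x ≤ u × B X z u)
  B⊎Refl-above {x} {z} x≤z with reflexive-between? x z
  ... | no none = inj₁ (¬reflexive-between⇒B x≤z none)
  ... | yes (v , x<v , v≤z , vR▷v) with maximal-Refl-below vR▷v v≤z
  ...   | u , uR▷u , v≤u , zBu = inj₂ (u , uR▷u , ≤-trans x v u (proj₁ x<v) v≤u , zBu)

  BClosed : Subset n → Set
  BClosed S = ∀ {y w} → y ∈ₛ S → B X y w → w ∈ₛ S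

  archival⇒BClosed : ∀ {S} → Archival X S → BClosed S
  archival⇒BClosed {S} archival y∈S yBw = ¬-not (go (<-wellFounded _) y∈S yBw)
    where
    go : ∀ {y w} → Acc (_<_ X) y → y ∈ₛ S → B X y w → ¬ w ∉ₛ S
    go {y} {w} (acc below) y∈S (w≤y , noRefl) w∉S
      with archival w y w∉S y∈S (from (R◁-converse y w) (<⇒R▷ (w≤y , ∉∈⇒≢ w∉S y∈S)))
    ... | y′ , yR◁y′ , w≤y′ , y′∈S with y′ ≟ y | to (R◁-converse y y′) yR◁y′
    ...   | yes refl | yR▷y = noRefl y (w≤y , ∉∈⇒≢ w∉S y∈S) (≤-refl y) yR▷y
    ...   | no y′≢y  | y′R▷y =
            go (below (R▷⇒≤ y′R▷y , y′≢y)) y′∈S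
               (w≤y′ , λ v w<v v≤y′ → noRefl v w<v (≤-trans v y′ y v≤y′ (R▷⇒≤ y′R▷y)))
               w∉S

  BClosed⇒archival : ∀ {S} → BClosed S → Archival X S
  BClosed⇒archival B-closed x z x∉S z∈S zR◁x
    with B⊎Refl-above (R▷⇒≤ (to (R◁-converse z x) zR◁x))
  ... | inj₁ zBx = contradiction (B-closed z∈S zBx) (not-¬ x∉S)
  ... | inj₂ (u , uR▷u , x≤u , zBu@(u≤z , _)) =
        u , from (R◁-converse z u) (Refl-≤⇒R▷ uR▷u u≤z) , x≤u , B-closed z∈S zBu

  module _ (x : Fin n) where

    Zₙ-mono : ∀ k → Zₙ X k x ⊆ Zₙ X (suc k) x
    Zₙ-mono k {z} xZₖz = z , xZₖz , z , B-refl z , ≤-refl z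

    Zₙ-refl : ∀ k → Zₙ X k x x
    Zₙ-refl zero    = refl
    Zₙ-refl (suc k) = Zₙ-mono k (Zₙ-refl k)

    Zₙ⊆BClosedUpSet : ∀ {S} → UpSet S → BClosed S → x ∈ₛ S → ∀ k {z} → Zₙ X k x z → z ∈ₛ S
    Zₙ⊆BClosedUpSet up B-closed x∈S zero    refl = x∈S
    Zₙ⊆BClosedUpSet up B-closed x∈S (suc k) (y , xZₖy , w , yBw , w≤z) =
      up _ _ w≤z (B-closed (Zₙ⊆BClosedUpSet up B-closed x∈S k xZₖy) yBw)

    ZRoot⇒TopoRoot : IsZRoot X x → IsTopoRoot X x
    ZRoot⇒TopoRoot xZ z S _ archival up x∈S with xZ z
    ... | k , xZₖz = Zₙ⊆BClosedUpSet up (archival⇒BClosed archival) x∈S k xZₖz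

    TopoRoot⇒ZRoot : IsTopoRoot X x → IsZRoot X x
    TopoRoot⇒ZRoot x⊴ z with increasing-stabilises (λ k → Zₙ? k x) Zₙ-mono
    ... | j , stable =
      j , toSubset⁻ (Zₙ? j x)
            (x⊴ z Zⱼ (discrete Zⱼ) (BClosed⇒archival (λ y∈ yBw → step y∈ yBw (≤-refl _)))
                (λ _ _ y≤y′ y∈ → step y∈ (B-refl _) y≤y′) (toSubset⁺ (Zₙ? j x) (Zₙ-refl j)))
      where
      Zⱼ : Subset n
      Zⱼ = toSubset (Zₙ? j x)

      step : ∀ {y w y′} → y ∈ₛ Zⱼ → B X y w → w ≤ y′ → y′ ∈ₛ Zⱼ
      step {y} {w} y∈Zⱼ yBw w≤y′ =
        toSubset⁺ (Zₙ? j x) (stable (y , toSubset⁻ (Zₙ? j x) y∈Zⱼ , w , yBw , w≤y′))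

    topoRoot⇔ZRoot : IsTopoRoot X x ⇔ IsZRoot X x
    topoRoot⇔ZRoot = mk⇔ TopoRoot⇒ZRoot ZRoot⇒TopoRoot

corollary4p10 : (n : ℕ) (X : FiniteTemporalEsakiaSpace n) →
                ((x : Fin n) → IsTopoRoot X x ⇔ IsZRoot X x) ×
                (TopoConnected X ⇔ ZConnected X)
corollary4p10 n X =
  topoRoot⇔ZRoot X ,
  mk⇔ (λ connected x → to (topoRoot⇔ZRoot X x) (connected x))
      (λ connected x → from (topoRoot⇔ZRoot X x) (connected x))
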